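{- Let $M$ be a cellular pseudomanifold. (a) Let $f\subseteq V(M)$ be a set of vertices that misses exactly one vertex from each $\sim$-equivalence class. Then $f$ is the shadow of a face of dimension $\#(f)-1$. (b) If $f$ and $f'$ are two sets of vertices as in (a), then there is an automorphism $\varphi$ of $M$ with $f'=\varphi(f)$.
   Context: A finite lattice $(X,<)$ is ranked if there is $\rho:X\to\mathbb N$ such that for each $x$ every maximal chain from $\mathbf 0$ to $x$ has length $\rho(x)$. For a ranked lattice $L$ with top $\mathbf 1$, $\Lambda(L)$ is the graph on the elements of rank $\rho(\mathbf 1)-1$, with $\sigma\ne\gamma$ adjacent iff $\rho(\sigma\wedge\gamma)=\rho(\mathbf 1)-2$. A cellular pseudomanifold is a finite ranked lattice $M$ such that for all $x<z$: if $\rho(z)=\rho(x)+2$ there are exactly two $y$ with $x<y<z$, and if $\rho(z)>\rho(x)+2$ then $\Lambda([x,z])$ is connected. Faces are its elements, $\dim f=\rho(f)-1$; vertices are faces of dimension $0$, $V(M)$ the vertex set. The shadow of a face is the set of vertices below it; faces are identified with their shadows, and automorphisms act on vertex sets. For vertices $x,y$, $x\sim y$ iff $x=y$ or the transposition of $x$ and $y$ (fixing other vertices) induces an automorphism of $M$; this is an equivalence relation. -}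

module Defs where

open import Level using (0ℓ)
open import Data.Nat using (ℕ; zero; suc; _+_; _>_)
open import Data.Fin using (Fin)
open import Data.Fin.Subset using (Subset; _∈_; _∉_; ∣_∣)
open import Data.Product using (Σ; _×_; ∃; ∃-syntax; _,_)
open import Data.Sum using (_⊎_)
open import Data.Empty using (⊥)
open import Algebra.Core using (Op₂)
open import Relation.Binary.Core using (Rel)
open import Relation.Binary.Definitions using (Minimum; Maximum)
open import Relation.Binary.PropositionalEquality using (_≡_; _≢_)
open import Relation.Binary.Lattice.Structures using (IsLattice)
open import Function.Definitions using (Bijective)
open import Function.Bundles using (_⇔_)

-- Finite lattices: carrier Fin n, a partial order _≤_, join, meet.
-- The bottom 𝟎 and top 𝟏 (which exist in every finite nonempty lattice
-- and are unique) are recorded as data.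

record FinLattice : Set₁ where
  field
    size       : ℕ
    _≤_        : Rel (Fin size) 0ℓ
    _∨_        : Op₂ (Fin size)
    _∧_        : Op₂ (Fin size)
    isLattice  : IsLattice _≡_ _≤_ _∨_ _∧_
    𝟎          : Fin size
    𝟏          : Fin size
    𝟎-minimum  : Minimum _≤_ 𝟎
    𝟏-maximum  : Maximum _≤_ 𝟏

  Elt : Set
  Elt = Fin size

  _<_ : Rel Elt 0ℓ
  x < y = (x ≤ y) × (x ≢ y)

  _⋖_ : Rel Elt 0ℓ
  x ⋖ y = (x < y) × (∀ z → x < z → z < y → ⊥)

  -- saturated chains x = x₀ ⋖ x₁ ⋖ … ⋖ x_k = y, indexed by their length k.
  -- (In a finite poset the maximal chains of the interval [x,y] are exactly these.)
  data MaxChain : Elt → Elt → ℕ → Set where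
    [_]  : ∀ x → MaxChain x x zero
    _∷_  : ∀ {x y z k} → x ⋖ y → MaxChain y z k → MaxChain x z (suc k)

  IsRankFunction : (Elt → ℕ) → Set
  IsRankFunction ρ = ∀ x k → MaxChain 𝟎 x k → k ≡ ρ x

  record Automorphism : Set where
    field
      φ          : Elt → Elt
      bijective  : Bijective _≡_ _≡_ φ
      preserves  : ∀ x y → x ≤ y → φ x ≤ φ y
      reflects   : ∀ x y → φ x ≤ φ y → x ≤ y

module _ {A : Set} (Vert : A → Set) (Adj : A → A → Set) where

  data Walk : A → A → Set where
    stay : ∀ {a} → Walk a a
    step : ∀ {a b c} → Adj a b → Vert b → Walk b c → Walk a c

  Connected : Set
  Connected = ∀ a b → Vert a → Vert b → Walk a b

record CellularPseudomanifold : Set₁ where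
  field
    lattice : FinLattice
  open FinLattice lattice public
  field
    ρ       : Elt → ℕ
    ranked  : IsRankFunction ρ

  -- Λ([x,z]): the interval [x,z] is ranked by y ↦ ρ y ∸ ρ x with top z;
  -- its vertices are the y with x ≤ y ≤ z of rank one below z, and
  -- σ ≠ γ are adjacent iff their meet has rank two below z
  -- (the meet in [x,z] is the meet in the lattice).
  ΛVert : Elt → Elt → Elt → Set
  ΛVert x z y = (x ≤ y) × (y ≤ z) × (suc (ρ y) ≡ ρ z)

  ΛAdj : Elt → Rel Elt 0ℓ
  ΛAdj z σ γ = (σ ≢ γ) × (suc (suc (ρ (σ ∧ γ))) ≡ ρ z)

  field
    diamond : ∀ x z → x < z → ρ z ≡ ρ x + 2 →
              Σ Elt λ y₁ → Σ Elt λ y₂ → (y₁ ≢ y₂)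
                × (x < y₁) × (y₁ < z) × (x < y₂) × (y₂ < z)
                × (∀ y → x < y → y < z → (y ≡ y₁) ⊎ (y ≡ y₂))
    connected : ∀ x z → x < z → ρ z > ρ x + 2 →
                Connected (ΛVert x z) (ΛAdj z)

  -- faces of dimension 0, i.e. rank 1
  IsVertex : Elt → Set
  IsVertex v = ρ v ≡ 1

  IsShadowOf : Subset size → Elt → Set
  IsShadowOf f g = ∀ v → (v ∈ f) ⇔ (IsVertex v × v ≤ g)

  _∼_ : Rel Elt 0ℓ
  x ∼ y = (x ≡ y) ⊎
          (Σ Automorphism λ α → let open Automorphism α in
             (φ x ≡ y) × (φ y ≡ x) ×
             (∀ v → IsVertex v → v ≢ x → v ≢ y → φ v ≡ v))

  MissesOnePerClass : Subset size → Set
  MissesOnePerClass f =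
    (∀ v → v ∈ f → IsVertex v) ×
    (∀ v → IsVertex v →
       Σ Elt λ w → IsVertex w × (v ∼ w) × (w ∉ f) ×
         (∀ w' → IsVertex w' → v ∼ w' → w' ∉ f → w' ≡ w))

  MapsOnto : Automorphism → Subset size → Subset size → Set
  MapsOnto α f f' = ∀ v → (v ∈ f') ⇔ (Σ Elt λ u → (u ∈ f) × (Automorphism.φ α u ≡ v))

-- A cellular pseudomanifold is atomistic: by the diamond property every face is the join of the
-- vertices below it. The heart of the matter is a transposition τ of two vertices x and y. A face
-- avoiding x and y is fixed by τ, and a τ-fixed face containing x has no facet avoiding both x and
-- y: by induction on the rank, "avoids x and y" propagates along walks in the connected graph
-- Λ([𝟎, z]), since two adjacent facets a, a' and τ a' cannot be three distinct faces of a
-- rank-two interval. Consequently, for g avoiding x and y, g ∨ x covers g and its vertices are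
-- those of g together with x (a downward induction on g, again using the diamond property).
-- (a) The ∼-partner of each vertex of f lies outside f, so adding the vertices of f one at a time
-- raises the rank by one each time. (b) If v ∈ f' ∖ f, then its partner w ∉ f' lies in f, and the
-- transposition of v and w moves f one step closer to f'.
module Submission where

open import Defs
open import Data.Fin.Subset using (Subset; ∣_∣)
open import Data.Product using (Σ; _×_)
open import Relation.Binary.PropositionalEquality using (_≡_)

open import Data.Nat as ℕ using (ℕ; suc; _+_)
import Data.Nat.Properties as ℕ
import Data.Nat.Induction as ℕ
open import Data.Empty using (⊥; ⊥-elim)
open import Data.Fin using (zero; suc; _≟_)
open import Data.Fin.Properties using (any?)
open import Data.Fin.Induction using (po-wellFounded; po-noetherian)
open import Data.Fin.Subset using (_∈_; _∉_; _⊆_; _─_; _-_; inside; outside)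
open import Data.Fin.Subset.Properties
  using ( _∈?_; nonempty?; Empty-unique; ∣⊥∣≡0; x∈⁅x⁆; p─⊥≡p; p─q⊆p; x∈p∧x∉q⇒x∈p─q
        ; x∈p∧x≢y⇒x∈p-y; x∈p⇒∣p-x∣<∣p∣; p⊂q⇒∣p∣<∣q∣)
open import Data.Product using (_,_; proj₁; proj₂; ∃; ∃-syntax)
open import Data.Sum using (_⊎_; inj₁; inj₂; [_,_]′)
open import Data.Vec using (_∷_; here; there; tabulate; lookup)
open import Data.Vec.Properties using (lookup∘tabulate; []=⇒lookup; lookup⇒[]=)
open import Function using (_∘_; id; flip)
open import Function.Bundles using (mk⇔; Equivalence)
open import Function.Consequences.Propositional
  using ( inverseᵇ⇒bijective; strictlyInverseˡ⇒inverseˡ; strictlyInverseʳ⇒inverseʳ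
        ; surjective⇒strictlySurjective)
open import Induction.WellFounded using (WellFounded; Acc; acc)
open import Relation.Binary.Definitions using (Decidable)
open import Relation.Binary.Lattice.Structures using (IsLattice)
open import Relation.Binary.PropositionalEquality
  using (refl; sym; trans; cong; cong₂; subst; subst₂; _≢_)
open import Relation.Nullary using (yes; no; ¬_)
open import Relation.Nullary.Decidable using (_×-dec_)

∈∧∉⇒≢ : ∀ {n} {p : Subset n} {x y} → x ∈ p → y ∉ p → x ≢ y
∈∧∉⇒≢ {p = p} x∈p y∉p x≡y = y∉p (subst (_∈ p) x≡y x∈p)

x∈p─q⇒x∉q : ∀ {n} {p q : Subset n} {x} → x ∈ p ─ q → x ∉ q
x∈p─q⇒x∉q {p = _ ∷ _} {outside ∷ _} {zero}  _          ()
x∈p─q⇒x∉q {p = _ ∷ _} {inside  ∷ _} {zero}  ()         _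
x∈p─q⇒x∉q {p = _ ∷ _} {_ ∷ _}       {suc x} (there x∈) (there x∈q) = x∈p─q⇒x∉q x∈ x∈q

∣p∣≡suc∣p-x∣ : ∀ {n} {p : Subset n} {x} → x ∈ p → ∣ p ∣ ≡ suc ∣ p - x ∣
∣p∣≡suc∣p-x∣ {p = inside  ∷ p} {zero}  here        = cong (suc ∘ ∣_∣) (sym (p─⊥≡p p))
∣p∣≡suc∣p-x∣ {p = inside  ∷ p} {suc x} (there x∈p) = cong suc (∣p∣≡suc∣p-x∣ x∈p)
∣p∣≡suc∣p-x∣ {p = outside ∷ p} {suc x} (there x∈p) = ∣p∣≡suc∣p-x∣ x∈p

no-three-in-pair : ∀ {A : Set} {a b c y₁ y₂ : A} → a ≢ b → a ≢ c → b ≢ c →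
                   a ≡ y₁ ⊎ a ≡ y₂ → b ≡ y₁ ⊎ b ≡ y₂ → c ≡ y₁ ⊎ c ≡ y₂ → ⊥
no-three-in-pair a≢b a≢c b≢c (inj₁ refl) (inj₁ refl) _           = a≢b refl
no-three-in-pair a≢b a≢c b≢c (inj₂ refl) (inj₂ refl) _           = a≢b refl
no-three-in-pair a≢b a≢c b≢c (inj₁ refl) (inj₂ refl) (inj₁ refl) = a≢c refl
no-three-in-pair a≢b a≢c b≢c (inj₁ refl) (inj₂ refl) (inj₂ refl) = b≢c refl
no-three-in-pair a≢b a≢c b≢c (inj₂ refl) (inj₁ refl) (inj₁ refl) = b≢c refl
no-three-in-pair a≢b a≢c b≢c (inj₂ refl) (inj₁ refl) (inj₂ refl) = a≢c refl

module FinLatticeProperties (L : FinLattice) where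
  open FinLattice L
  open IsLattice isLattice public
    using (isPartialOrder; antisym; x≤x∨y; y≤x∨y; ∨-least; x∧y≤x; x∧y≤y; ∧-greatest)
    renaming (refl to ≤-refl; trans to ≤-trans)

  _≤?_ : Decidable _≤_
  x ≤? y with x ∨ y ≟ y
  ... | yes x∨y≡y = yes (subst (x ≤_) x∨y≡y (x≤x∨y x y))
  ... | no  x∨y≢y = no λ x≤y → x∨y≢y (antisym (∨-least x≤y ≤-refl) (y≤x∨y x y))

  _<?_ : Decidable _<_
  x <? y with x ≤? y | x ≟ y
  ... | yes x≤y | no  x≢y = yes (x≤y , x≢y)
  ... | yes _   | yes x≡y = no λ x<y → proj₂ x<y x≡y
  ... | no  x≰y | _       = no λ x<y → x≰y (proj₁ x<y)

  <-wellFounded : WellFounded _<_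
  <-wellFounded = po-wellFounded isPartialOrder

  <-noetherian : WellFounded (flip _<_)
  <-noetherian = po-noetherian isPartialOrder

  <-≤-trans : ∀ {x y z} → x < y → y ≤ z → x < z
  <-≤-trans (x≤y , x≢y) y≤z = ≤-trans x≤y y≤z , λ { refl → x≢y (antisym x≤y y≤z) }

  ≰⇒<∨ : ∀ {x y} → ¬ y ≤ x → x < (x ∨ y)
  ≰⇒<∨ {x} {y} y≰x = x≤x∨y x y , λ x≡x∨y → y≰x (subst (y ≤_) (sym x≡x∨y) (y≤x∨y x y))

  ⋖-squeeze : ∀ {x y z} → x ⋖ z → x ≤ y → y < z → y ≡ x
  ⋖-squeeze {x} {y} (_ , nothing-between) x≤y y<z with x ≟ y
  ... | yes x≡y = sym x≡y
  ... | no  x≢y = ⊥-elim (nothing-between y (x≤y , x≢y) y<z)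

  ∃-cover : ∀ {x y} → x < y → ∃[ m ] (x ⋖ m × m ≤ y)
  ∃-cover {x} {y} = go (<-wellFounded y)
    where
    go : ∀ {y} → Acc _<_ y → x < y → ∃[ m ] (x ⋖ m × m ≤ y)
    go {y} (acc below) x<y with any? (λ z → (x <? z) ×-dec (z <? y))
    ... | no  nothing-between = y , (x<y , λ z x<z z<y → nothing-between (z , x<z , z<y)) , ≤-refl
    ... | yes (z , x<z , z<y) with go (below z<y) x<z
    ...   | m , x⋖m , m≤z = m , x⋖m , ≤-trans m≤z (proj₁ z<y)

  ∃-cocover : ∀ {x y} → x < y → ∃[ c ] (x ≤ c × c ⋖ y)
  ∃-cocover {x} {y} = go (<-noetherian x)
    where
    go : ∀ {x} → Acc (flip _<_) x → x < y → ∃[ c ] (x ≤ c × c ⋖ y)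
    go {x} (acc above) x<y with any? (λ z → (x <? z) ×-dec (z <? y))
    ... | no  nothing-between = x , ≤-refl , x<y , λ z x<z z<y → nothing-between (z , x<z , z<y)
    ... | yes (z , x<z , z<y) with go (above x<z) z<y
    ...   | c , z≤c , c⋖y = c , ≤-trans (proj₁ x<z) z≤c , c⋖y

  ∃-maxChain : ∀ {x y} → x ≤ y → ∃ (MaxChain x y)
  ∃-maxChain {x} {y} = go (<-noetherian x)
    where
    go : ∀ {x} → Acc (flip _<_) x → x ≤ y → ∃ (MaxChain x y)
    go {x} (acc above) x≤y with x ≟ y
    ... | yes refl = 0 , [ x ]
    ... | no  x≢y with ∃-cover (x≤y , x≢y)
    ...   | m , x⋖m , m≤y with go (above (proj₁ x⋖m)) m≤y
    ...     | k , m⋯y = suc k , (x⋖m ∷ m⋯y)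

  _++ᶜ_ : ∀ {x y z k l} → MaxChain x y k → MaxChain y z l → MaxChain x z (k + l)
  [ _ ]       ++ᶜ y⋯z = y⋯z
  (x⋖w ∷ w⋯y) ++ᶜ y⋯z = x⋖w ∷ (w⋯y ++ᶜ y⋯z)

  Monotone : (Elt → Elt) → Set
  Monotone f = ∀ {x y} → x ≤ y → f x ≤ f y

  fromInverses : (f g : Elt → Elt) → Monotone f → Monotone g →
                 (∀ y → f (g y) ≡ y) → (∀ x → g (f x) ≡ x) → Automorphism
  fromInverses f g f-mono g-mono fg≗id gf≗id = record
    { φ         = f
    ; bijective = inverseᵇ⇒bijective
                    (strictlyInverseˡ⇒inverseˡ f fg≗id , strictlyInverseʳ⇒inverseʳ f gf≗id)
    ; preserves = λ _ _ → f-mono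
    ; reflects  = λ x y fx≤fy → subst₂ _≤_ (gf≗id x) (gf≗id y) (g-mono fx≤fy)
    }

  module AutomorphismProperties (α : Automorphism) where
    open Automorphism α public

    φ⁻¹ : Elt → Elt
    φ⁻¹ y = proj₁ (surjective⇒strictlySurjective (proj₂ bijective) y)

    φ-φ⁻¹ : ∀ y → φ (φ⁻¹ y) ≡ y
    φ-φ⁻¹ y = proj₂ (surjective⇒strictlySurjective (proj₂ bijective) y)

    φ-injective : ∀ {x y} → φ x ≡ φ y → x ≡ y
    φ-injective = proj₁ bijective

    φ⁻¹-φ : ∀ x → φ⁻¹ (φ x) ≡ x
    φ⁻¹-φ x = φ-injective (φ-φ⁻¹ (φ x))

    φ-mono : Monotone φ
    φ-mono = preserves _ _

    φ⁻¹-mono : Monotone φ⁻¹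
    φ⁻¹-mono {x} {y} x≤y = reflects _ _ (subst₂ _≤_ (sym (φ-φ⁻¹ x)) (sym (φ-φ⁻¹ y)) x≤y)

    φ-< : ∀ {x y} → x < y → φ x < φ y
    φ-< (x≤y , x≢y) = φ-mono x≤y , x≢y ∘ φ-injective

    φ⁻¹-< : ∀ {x y} → x < y → φ⁻¹ x < φ⁻¹ y
    φ⁻¹-< {x} {y} (x≤y , x≢y) =
      φ⁻¹-mono x≤y , λ e → x≢y (trans (sym (φ-φ⁻¹ x)) (trans (cong φ e) (φ-φ⁻¹ y)))

    φ-⋖ : ∀ {x y} → x ⋖ y → φ x ⋖ φ y
    φ-⋖ {x} {y} (x<y , nothing-between) = φ-< x<y , λ z φx<z z<φy →
      nothing-between (φ⁻¹ z) (subst (_< φ⁻¹ z) (φ⁻¹-φ x) (φ⁻¹-< φx<z))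
                              (subst (φ⁻¹ z <_) (φ⁻¹-φ y) (φ⁻¹-< z<φy))

    φ-maxChain : ∀ {x y k} → MaxChain x y k → MaxChain (φ x) (φ y) k
    φ-maxChain [ x ]       = [ φ x ]
    φ-maxChain (x⋖w ∷ w⋯y) = φ-⋖ x⋖w ∷ φ-maxChain w⋯y

    φ-𝟎 : φ 𝟎 ≡ 𝟎
    φ-𝟎 = antisym (subst (φ 𝟎 ≤_) (φ-φ⁻¹ 𝟎) (φ-mono (𝟎-minimum (φ⁻¹ 𝟎)))) (𝟎-minimum (φ 𝟎))

    φ-∨ : ∀ x y → φ (x ∨ y) ≡ φ x ∨ φ y
    φ-∨ x y = antisym
      (subst (φ (x ∨ y) ≤_) (φ-φ⁻¹ _) (φ-mono (∨-least (below x (x≤x∨y _ _)) (below y (y≤x∨y _ _)))))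
      (∨-least (φ-mono (x≤x∨y x y)) (φ-mono (y≤x∨y x y)))
      where
      below : ∀ z → φ z ≤ (φ x ∨ φ y) → z ≤ φ⁻¹ (φ x ∨ φ y)
      below z φz≤ = subst (_≤ _) (φ⁻¹-φ z) (φ⁻¹-mono φz≤)

  _⁻¹ᴬ : Automorphism → Automorphism
  α ⁻¹ᴬ = fromInverses φ⁻¹ φ φ⁻¹-mono φ-mono φ⁻¹-φ φ-φ⁻¹
    where open AutomorphismProperties α

  _∘ᴬ_ : Automorphism → Automorphism → Automorphism
  β ∘ᴬ α = fromInverses (B.φ ∘ A.φ) (A.φ⁻¹ ∘ B.φ⁻¹) (B.φ-mono ∘ A.φ-mono) (A.φ⁻¹-mono ∘ B.φ⁻¹-mono)
             (λ y → trans (cong B.φ (A.φ-φ⁻¹ _)) (B.φ-φ⁻¹ y))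
             (λ x → trans (cong A.φ⁻¹ (B.φ⁻¹-φ _)) (A.φ⁻¹-φ x))
    where
    module A = AutomorphismProperties α
    module B = AutomorphismProperties β

  idᴬ : Automorphism
  idᴬ = fromInverses id id id id (λ _ → refl) (λ _ → refl)

module RankedLatticeProperties (L : FinLattice) (ρ : FinLattice.Elt L → ℕ)
                               (ranked : FinLattice.IsRankFunction L ρ) where
  open FinLattice L
  open FinLatticeProperties L

  ρ-𝟎 : ρ 𝟎 ≡ 0
  ρ-𝟎 = sym (ranked 𝟎 0 [ 𝟎 ])

  ρ≢0⇒𝟎< : ∀ {x} → ρ x ≢ 0 → 𝟎 < x
  ρ≢0⇒𝟎< {x} ρx≢0 = 𝟎-minimum x , λ 𝟎≡x → ρx≢0 (trans (cong ρ (sym 𝟎≡x)) ρ-𝟎)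

  ρ-maxChain : ∀ {x y k} → MaxChain x y k → ρ y ≡ ρ x + k
  ρ-maxChain {x} {y} {k} x⋯y with ∃-maxChain (𝟎-minimum x)
  ... | j , 𝟎⋯x = trans (sym (ranked y (j + k) (𝟎⋯x ++ᶜ x⋯y))) (cong (_+ k) (ranked x j 𝟎⋯x))

  ρ-⋖ : ∀ {x y} → x ⋖ y → ρ y ≡ suc (ρ x)
  ρ-⋖ {x} {y} x⋖y = trans (ρ-maxChain (x⋖y ∷ [ y ])) (ℕ.+-comm (ρ x) 1)

  ρ-⋖-⋖ : ∀ {x y z} → x ⋖ y → y ⋖ z → ρ z ≡ ρ x + 2
  ρ-⋖-⋖ {x} x⋖y y⋖z = trans (ρ-⋖ y⋖z) (trans (cong suc (ρ-⋖ x⋖y)) (ℕ.+-comm 2 (ρ x)))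

  ρ-< : ∀ {x y} → x < y → ρ x ℕ.< ρ y
  ρ-< x<y with ∃-cover x<y
  ... | m , x⋖m , m≤y with ∃-maxChain m≤y
  ...   | k , m⋯y = ℕ.≤-trans (ℕ.≤-reflexive (sym (ρ-⋖ x⋖m)))
                               (ℕ.≤-trans (ℕ.m≤m+n _ k) (ℕ.≤-reflexive (sym (ρ-maxChain m⋯y))))

  ρ-mono : ∀ {x y} → x ≤ y → ρ x ℕ.≤ ρ y
  ρ-mono {x} {y} x≤y with x ≟ y
  ... | yes refl = ℕ.≤-refl
  ... | no  x≢y  = ℕ.<⇒≤ (ρ-< (x≤y , x≢y))

  ≤∧ρ≡⇒≡ : ∀ {x y} → x ≤ y → ρ x ≡ ρ y → x ≡ y
  ≤∧ρ≡⇒≡ {x} {y} x≤y ρx≡ρy with x ≟ y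
  ... | yes x≡y = x≡y
  ... | no  x≢y = ⊥-elim (ℕ.<⇒≢ (ρ-< (x≤y , x≢y)) ρx≡ρy)

  ≤∧ρ≡suc⇒⋖ : ∀ {x y} → x ≤ y → ρ y ≡ suc (ρ x) → x ⋖ y
  ≤∧ρ≡suc⇒⋖ {x} {y} x≤y ρy≡1+ρx =
    (x≤y , λ { refl → ℕ.1+n≢n (sym ρy≡1+ρx) }) ,
    λ z x<z z<y → ℕ.<-irrefl refl
      (ℕ.<-≤-trans (ρ-< z<y) (ℕ.≤-trans (ℕ.≤-reflexive ρy≡1+ρx) (ρ-< x<z)))

  ρ-φ : ∀ α x → ρ (Automorphism.φ α x) ≡ ρ x
  ρ-φ α x with ∃-maxChain (𝟎-minimum x)
  ... | k , 𝟎⋯x = trans (sym (ranked (φ x) k (subst (λ b → MaxChain b (φ x) k) φ-𝟎 (φ-maxChain 𝟎⋯x))))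
                        (ranked x k 𝟎⋯x)
    where open AutomorphismProperties α

module CellularPseudomanifoldProperties (M : CellularPseudomanifold) where
  open CellularPseudomanifold M
  open FinLatticeProperties lattice
  open RankedLatticeProperties lattice ρ ranked

  Between : Elt → Elt → Elt → Set
  Between x z y = x < y × y < z

  between⇒< : ∀ {x y z} → Between x z y → x < z
  between⇒< (x<y , y<z) = <-≤-trans x<y (proj₁ y<z)

  at-most-two-between : ∀ {x z a b c} → ρ z ≡ ρ x + 2 →
                        Between x z a → Between x z b → Between x z c → a ≢ b → a ≢ c → b ≢ c → ⊥
  at-most-two-between {x} {z} ρz≡ρx+2 a∈ b∈ c∈ a≢b a≢c b≢c with diamond x z (between⇒< a∈) ρz≡ρx+2
  ... | y₁ , y₂ , _ , _ , _ , _ , _ , only =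
    no-three-in-pair a≢b a≢c b≢c (in-pair a∈) (in-pair b∈) (in-pair c∈)
    where
    in-pair : ∀ {y} → Between x z y → y ≡ y₁ ⊎ y ≡ y₂
    in-pair (x<y , y<z) = only _ x<y y<z

  another-between : ∀ {x z a} → ρ z ≡ ρ x + 2 → Between x z a → ∃[ b ] (b ≢ a × Between x z b)
  another-between {x} {z} {a} ρz≡ρx+2 a∈ with diamond x z (between⇒< a∈) ρz≡ρx+2
  ... | y₁ , y₂ , y₁≢y₂ , x<y₁ , y₁<z , x<y₂ , y₂<z , _ with y₁ ≟ a
  ...   | yes refl = y₂ , (λ y₂≡y₁ → y₁≢y₂ (sym y₂≡y₁)) , x<y₂ , y₂<z
  ...   | no  y₁≢a = y₁ , y₁≢a , x<y₁ , y₁<z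

  𝟎<vertex : ∀ {v} → IsVertex v → 𝟎 < v
  𝟎<vertex v-vertex = ρ≢0⇒𝟎< λ ρv≡0 → ℕ.1+n≢0 (trans (sym v-vertex) ρv≡0)

  ∃-facet-not-below : ∀ {c a} → c ⋖ a → ρ a ≢ 1 → ∃[ c' ] (c' < a × ¬ c' ≤ c)
  ∃-facet-not-below {c} c⋖a ρa≢1 with ∃-cocover (ρ≢0⇒𝟎< λ ρc≡0 → ρa≢1 (trans (ρ-⋖ c⋖a) (cong suc ρc≡0)))
  ... | d , _ , d⋖c with another-between (ρ-⋖-⋖ d⋖c c⋖a) (proj₁ d⋖c , proj₁ c⋖a)
  ...   | c' , c'≢c , d<c' , c'<a = c' , c'<a , λ c'≤c → proj₂ d⋖c c' d<c' (c'≤c , c'≢c)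

  ∃-vertex-outside : ∀ {m a} → m < a → ∃[ v ] (IsVertex v × v ≤ a × ¬ v ≤ m)
  ∃-vertex-outside {a = a} = go (<-wellFounded a)
    where
    go : ∀ {m a} → Acc _<_ a → m < a → ∃[ v ] (IsVertex v × v ≤ a × ¬ v ≤ m)
    go {m} {a} (acc below) m<a with ρ a ℕ.≟ 1
    ... | yes a-vertex = a , a-vertex , ≤-refl , λ a≤m → proj₂ m<a (antisym (proj₁ m<a) a≤m)
    ... | no  ρa≢1 =
      let c , m≤c , c⋖a = ∃-cocover m<a
          c' , c'<a , c'≰c = ∃-facet-not-below c⋖a ρa≢1
          v , v-vertex , v≤c' , v≰c'∧c =
            go (below c'<a) (x∧y≤x c' c , λ c'∧c≡c' → c'≰c (subst (_≤ c) c'∧c≡c' (x∧y≤y c' c)))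
      in v , v-vertex , ≤-trans v≤c' (proj₁ c'<a) , λ v≤m → v≰c'∧c (∧-greatest v≤c' (≤-trans v≤m m≤c))

  atomistic : ∀ {a b} → (∀ v → IsVertex v → v ≤ a → v ≤ b) → a ≤ b
  atomistic {a} {b} vertices-below with (a ∧ b) ≟ a
  ... | yes a∧b≡a = subst (_≤ b) a∧b≡a (x∧y≤y a b)
  ... | no  a∧b≢a with ∃-vertex-outside (x∧y≤x a b , a∧b≢a)
  ...   | v , v-vertex , v≤a , v≰a∧b = ⊥-elim (v≰a∧b (∧-greatest v≤a (vertices-below v v-vertex v≤a)))

  ⋖⇒ΛVert : ∀ {c z} → c ⋖ z → ΛVert 𝟎 z c
  ⋖⇒ΛVert {c} c⋖z = 𝟎-minimum c , proj₁ (proj₁ c⋖z) , sym (ρ-⋖ c⋖z)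

  Λ-between : ∀ {R z t} → ΛVert 𝟎 z t → R ≤ t → suc (suc (ρ R)) ≡ ρ z → Between R z t
  Λ-between (_ , t≤z , ρz≡1+ρt) R≤t ρz≡2+ρR =
    (R≤t , λ { refl → ℕ.1+n≢n (ℕ.suc-injective (trans ρz≡2+ρR (sym ρz≡1+ρt))) }) ,
    (t≤z , λ { refl → ℕ.1+n≢n ρz≡1+ρt })

  Transposition : Elt → Elt → Set
  Transposition x y = Σ Automorphism λ α → let open Automorphism α in
    (φ x ≡ y) × (φ y ≡ x) × (∀ v → IsVertex v → v ≢ x → v ≢ y → φ v ≡ v)

  module TranspositionProperties {x y : Elt} (x-vertex : IsVertex x) (x≢y : x ≢ y)
                                 (t : Transposition x y) where
    open AutomorphismProperties (proj₁ t)

    φx≡y : φ x ≡ y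
    φx≡y = proj₁ (proj₂ t)

    φy≡x : φ y ≡ x
    φy≡x = proj₁ (proj₂ (proj₂ t))

    φ-fixes : ∀ v → IsVertex v → v ≢ x → v ≢ y → φ v ≡ v
    φ-fixes = proj₂ (proj₂ (proj₂ t))

    y-vertex : IsVertex y
    y-vertex = trans (cong ρ (sym φx≡y)) (trans (ρ-φ (proj₁ t) x) x-vertex)

    x≤⇒y≤φ : ∀ {z} → x ≤ z → y ≤ φ z
    x≤⇒y≤φ x≤z = subst (_≤ φ _) φx≡y (φ-mono x≤z)

    y≤⇒x≤φ : ∀ {z} → y ≤ z → x ≤ φ z
    y≤⇒x≤φ y≤z = subst (_≤ φ _) φy≡x (φ-mono y≤z)

    x≤fixed⇒y≤ : ∀ {z} → x ≤ z → φ z ≡ z → y ≤ z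
    x≤fixed⇒y≤ x≤z φz≡z = subst (y ≤_) φz≡z (x≤⇒y≤φ x≤z)

    ≤φ⇒φ≡ : ∀ {z} → z ≤ φ z → φ z ≡ z
    ≤φ⇒φ≡ {z} z≤φz = sym (≤∧ρ≡⇒≡ z≤φz (sym (ρ-φ (proj₁ t) z)))

    Avoids : Elt → Set
    Avoids r = ¬ x ≤ r × ¬ y ≤ r

    avoids-mono : ∀ {r r'} → r ≤ r' → Avoids r' → Avoids r
    avoids-mono r≤r' (x≰r' , y≰r') = x≰r' ∘ flip ≤-trans r≤r' , y≰r' ∘ flip ≤-trans r≤r'

    φ-fixes-avoiding : ∀ {r} → Avoids r → φ r ≡ r
    φ-fixes-avoiding {r} (x≰r , y≰r) = ≤φ⇒φ≡ (atomistic λ v v-vertex v≤r →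
      subst (_≤ φ r) (φ-fixes v v-vertex (λ { refl → x≰r v≤r }) (λ { refl → y≰r v≤r })) (φ-mono v≤r))

    FacetsMeetPairBelow : Elt → Set
    FacetsMeetPairBelow z = ∀ {w R} → w < z → x ≤ w → φ w ≡ w → R ⋖ w → ¬ Avoids R

    avoids-Λ-step : ∀ {z a a'} → φ z ≡ z → FacetsMeetPairBelow z →
                    ΛVert 𝟎 z a → ΛVert 𝟎 z a' → ΛAdj z a a' → Avoids a → Avoids a'
    avoids-Λ-step {z} {a} {a'} φz≡z facets-meet a∈Λ a'∈Λ (a≢a' , ρz≡2+ρR) a-avoids =
      (λ x≤a' → meets (inj₁ x≤a')) , (λ y≤a' → meets (inj₂ y≤a'))
      where
      R : Elt
      R = a ∧ a'
      R-avoids : Avoids R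
      R-avoids = avoids-mono (x∧y≤x a a') a-avoids
      meets : x ≤ a' ⊎ y ≤ a' → ⊥
      meets hit with φ a' ≟ a'
      ... | yes φa'≡a' =
        facets-meet (proj₂ (Λ-between a'∈Λ (x∧y≤y a a') ρz≡2+ρR)) x≤a' φa'≡a' R⋖a' R-avoids
        where
        x≤a' : x ≤ a'
        x≤a' = [ id , (λ y≤a' → subst (x ≤_) φa'≡a' (y≤⇒x≤φ y≤a')) ]′ hit
        R⋖a' : R ⋖ a'
        R⋖a' = ≤∧ρ≡suc⇒⋖ (x∧y≤y a a') (ℕ.suc-injective (trans (proj₂ (proj₂ a'∈Λ)) (sym ρz≡2+ρR)))
      ... | no  φa'≢a' =
        at-most-two-between (trans (sym ρz≡2+ρR) (ℕ.+-comm 2 (ρ R)))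
          (Λ-between a∈Λ (x∧y≤x a a') ρz≡2+ρR) (Λ-between a'∈Λ (x∧y≤y a a') ρz≡2+ρR)
          (Λ-between φa'∈Λ R≤φa' ρz≡2+ρR) a≢a' a≢φa' (φa'≢a' ∘ sym)
        where
        φa'∈Λ : ΛVert 𝟎 z (φ a')
        φa'∈Λ = 𝟎-minimum _ , subst (φ a' ≤_) φz≡z (φ-mono (proj₁ (proj₂ a'∈Λ))) ,
                trans (cong suc (ρ-φ (proj₁ t) a')) (proj₂ (proj₂ a'∈Λ))
        R≤φa' : R ≤ φ a'
        R≤φa' = subst (_≤ φ a') (φ-fixes-avoiding R-avoids) (φ-mono (x∧y≤y a a'))
        a≢φa' : a ≢ φ a'
        a≢φa' a≡φa' = [ (λ x≤a' → proj₂ a-avoids (subst (y ≤_) (sym a≡φa') (x≤⇒y≤φ x≤a')))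
                      , (λ y≤a' → proj₁ a-avoids (subst (x ≤_) (sym a≡φa') (y≤⇒x≤φ y≤a'))) ]′ hit

    avoids-along-walk : ∀ {z a b} → φ z ≡ z → FacetsMeetPairBelow z →
                        Walk (ΛVert 𝟎 z) (ΛAdj z) a b → ΛVert 𝟎 z a → Avoids a → Avoids b
    avoids-along-walk φz≡z facets-meet stay                 _   a-avoids = a-avoids
    avoids-along-walk φz≡z facets-meet (step adj a'∈Λ a'⋯b) a∈Λ a-avoids =
      avoids-along-walk φz≡z facets-meet a'⋯b a'∈Λ (avoids-Λ-step φz≡z facets-meet a∈Λ a'∈Λ adj a-avoids)

    no-avoiding-facet-of-rank≥3 : ∀ {z c k} → FacetsMeetPairBelow z → x ≤ z → φ z ≡ z → c ⋖ z →
                                  ρ z ≡ 3 + k → ¬ Avoids c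
    no-avoiding-facet-of-rank≥3 {z} {c} facets-meet x≤z φz≡z c⋖z ρz≡3+k c-avoids
      with ∃-cocover (x≤z , λ x≡z →
             ℕ.0≢1+n (ℕ.suc-injective (trans (sym x-vertex) (trans (cong ρ x≡z) ρz≡3+k))))
    ... | c' , x≤c' , c'⋖z = proj₁ (avoids-along-walk φz≡z facets-meet c⋯c' (⋖⇒ΛVert c⋖z) c-avoids) x≤c'
      where
      ρz>ρ𝟎+2 : ρ z ℕ.> ρ 𝟎 + 2
      ρz>ρ𝟎+2 = subst₂ ℕ._<_ (cong (_+ 2) (sym ρ-𝟎)) (sym ρz≡3+k) (ℕ.s≤s (ℕ.s≤s (ℕ.s≤s ℕ.z≤n)))
      c⋯c' : Walk (ΛVert 𝟎 z) (ΛAdj z) c c'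
      c⋯c' = connected 𝟎 z (ρ≢0⇒𝟎< (ℕ.1+n≢0 ∘ trans (sym ρz≡3+k))) ρz>ρ𝟎+2
                       c c' (⋖⇒ΛVert c⋖z) (⋖⇒ΛVert c'⋖z)

    no-avoiding-facet : ∀ {z c} → x ≤ z → φ z ≡ z → c ⋖ z → ¬ Avoids c
    no-avoiding-facet {z} = go (<-wellFounded z)
      where
      go : ∀ {z c} → Acc _<_ z → x ≤ z → φ z ≡ z → c ⋖ z → ¬ Avoids c
      go {z} {c} (acc below) x≤z φz≡z c⋖z c-avoids with ρ c in ρc≡
      ... | 0 = x≢y (trans (≤∧ρ≡⇒≡ x≤z (trans x-vertex (sym ρz≡1)))
                           (sym (≤∧ρ≡⇒≡ (x≤fixed⇒y≤ x≤z φz≡z) (trans y-vertex (sym ρz≡1)))))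
        where
        ρz≡1 : ρ z ≡ 1
        ρz≡1 = trans (ρ-⋖ c⋖z) (cong suc ρc≡)
      ... | 1 = at-most-two-between (trans ρz≡2 (cong (_+ 2) (sym ρ-𝟎)))
                  (vertex-between x-vertex x≤z) (vertex-between y-vertex (x≤fixed⇒y≤ x≤z φz≡z))
                  (vertex-between ρc≡ (proj₁ (proj₁ c⋖z)))
                  x≢y (λ { refl → proj₁ c-avoids ≤-refl }) (λ { refl → proj₂ c-avoids ≤-refl })
        where
        ρz≡2 : ρ z ≡ 2
        ρz≡2 = trans (ρ-⋖ c⋖z) (cong suc ρc≡)
        vertex-between : ∀ {v} → IsVertex v → v ≤ z → Between 𝟎 z v
        vertex-between v-vertex v≤z =
          𝟎<vertex v-vertex , v≤z , λ { refl → ℕ.1+n≢n (trans (sym ρz≡2) v-vertex) }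
      ... | suc (suc k) = no-avoiding-facet-of-rank≥3 (λ w<z → go (below w<z)) x≤z φz≡z c⋖z
                            (trans (ρ-⋖ c⋖z) (cong suc ρc≡)) c-avoids

    φ-join : ∀ {g} → Avoids g → φ (g ∨ x) ≡ g ∨ y
    φ-join {g} g-avoids = trans (φ-∨ g x) (cong₂ _∨_ (φ-fixes-avoiding g-avoids) φx≡y)

    ≤-join-vertex : ∀ {g v} → Avoids g → g ⋖ (g ∨ x) → IsVertex v → v ≢ x → v ≤ (g ∨ x) → v ≤ g
    ≤-join-vertex {g} {v} g-avoids g⋖h v-vertex v≢x v≤h = subst (v ≤_) h∧φh≡g (∧-greatest v≤h v≤φh)
      where
      h : Elt
      h = g ∨ x
      y≰h : ¬ y ≤ h
      y≰h y≤h = no-avoiding-facet (y≤x∨y g x) φh≡h g⋖h g-avoids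
        where
        φh≡h : φ h ≡ h
        φh≡h = ≤∧ρ≡⇒≡ (subst (_≤ h) (sym (φ-join g-avoids)) (∨-least (x≤x∨y g x) y≤h)) (ρ-φ (proj₁ t) h)
      v≤φh : v ≤ φ h
      v≤φh = subst (_≤ φ h) (φ-fixes v v-vertex v≢x (λ v≡y → y≰h (subst (_≤ h) v≡y v≤h))) (φ-mono v≤h)
      g≤φh : g ≤ φ h
      g≤φh = subst (_≤ φ h) (φ-fixes-avoiding g-avoids) (φ-mono (x≤x∨y g x))
      h∧φh≢h : h ∧ φ h ≢ h
      h∧φh≢h h∧φh≡h =
        y≰h (subst (y ≤_) (≤φ⇒φ≡ (subst (_≤ φ h) h∧φh≡h (x∧y≤y h (φ h)))) (x≤⇒y≤φ (y≤x∨y g x)))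
      h∧φh≡g : h ∧ φ h ≡ g
      h∧φh≡g = ⋖-squeeze g⋖h (∧-greatest (x≤x∨y g x) g≤φh) (x∧y≤x h (φ h) , h∧φh≢h)

    ≤-join⇒≤ : ∀ {p q} → Avoids q → q ⋖ (q ∨ x) → ¬ x ≤ p → p ≤ (q ∨ x) → p ≤ q
    ≤-join⇒≤ {p} q-avoids q⋖q∨x x≰p p≤q∨x = atomistic λ v v-vertex v≤p →
      ≤-join-vertex q-avoids q⋖q∨x v-vertex (λ v≡x → x≰p (subst (_≤ p) v≡x v≤p)) (≤-trans v≤p p≤q∨x)

    avoids-below-join : ∀ {g w} → Avoids g → g ≤ w → w < (g ∨ x) → Avoids w
    avoids-below-join {g} {w} g-avoids g≤w w<h =
      (λ x≤w → proj₂ w<h (antisym (proj₁ w<h) (∨-least g≤w x≤w))) ,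
      (λ y≤w → ℕ.<-irrefl refl (ℕ.<-≤-trans (ρ-< w<h) (ρh≤ρw y≤w)))
      where
      ρh≤ρw : y ≤ w → ρ (g ∨ x) ℕ.≤ ρ w
      ρh≤ρw y≤w = subst (ℕ._≤ ρ w) (ρ-φ (proj₁ t) (g ∨ x))
                    (ρ-mono (subst (_≤ w) (sym (φ-join g-avoids)) (∨-least g≤w y≤w)))

    join-absorbs : ∀ {g w} → g ≤ w → w ≤ (g ∨ x) → (w ∨ x) ≡ (g ∨ x)
    join-absorbs {g} {w} g≤w w≤h =
      antisym (∨-least w≤h (y≤x∨y g x)) (∨-least (≤-trans g≤w (x≤x∨y w x)) (y≤x∨y w x))

    no-cover-strictly-below-join : ∀ {g g'} → Avoids g → (∀ {w} → g < w → Avoids w → w ⋖ (w ∨ x)) →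
                                   g ⋖ g' → g' < (g ∨ x) → ⊥
    no-cover-strictly-below-join {g} {g'} g-avoids covers g⋖g' g'<h =
      let g'' , g''≢g' , g<g'' , g''<h = another-between ρh≡ρg+2 (proj₁ g⋖g' , g'<h)
      in g''≢g' (antisym (below-other g<g'' g''<h (proj₁ g⋖g') g'<h)
                         (below-other (proj₁ g⋖g') g'<h g<g'' g''<h))
      where
      covers-join : ∀ {w} → g < w → w < (g ∨ x) → w ⋖ (g ∨ x)
      covers-join g<w w<h = subst (_ ⋖_) (join-absorbs (proj₁ g<w) (proj₁ w<h))
                              (covers g<w (avoids-below-join g-avoids (proj₁ g<w) w<h))
      ρh≡ρg+2 : ρ (g ∨ x) ≡ ρ g + 2
      ρh≡ρg+2 = ρ-⋖-⋖ g⋖g' (covers-join (proj₁ g⋖g') g'<h)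
      below-other : ∀ {p q} → g < p → p < (g ∨ x) → g < q → q < (g ∨ x) → p ≤ q
      below-other {p} {q} g<p p<h g<q q<h =
        ≤-join⇒≤ q-avoids (covers g<q q-avoids) (proj₁ (avoids-below-join g-avoids (proj₁ g<p) p<h))
                 (subst (p ≤_) (sym (join-absorbs (proj₁ g<q) (proj₁ q<h))) (proj₁ p<h))
        where
        q-avoids : Avoids q
        q-avoids = avoids-below-join g-avoids (proj₁ g<q) q<h

    join-⋖ : ∀ {g} → Avoids g → g ⋖ (g ∨ x)
    join-⋖ {g} = go (<-noetherian g)
      where
      go : ∀ {g} → Acc (flip _<_) g → Avoids g → g ⋖ (g ∨ x)
      go {g} (acc above) g-avoids
        with ∃-cover (≰⇒<∨ (proj₁ g-avoids))
      ... | g' , g⋖g' , g'≤h with g' ≟ g ∨ x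
      ...   | yes refl = g⋖g'
      ...   | no  g'≢h =
        ⊥-elim (no-cover-strictly-below-join g-avoids (λ g<w → go (above g<w)) g⋖g' (g'≤h , g'≢h))

    shadow-∨ : ∀ {s g} → (∀ v → v ∈ s → IsVertex v) → x ∈ s → IsShadowOf (s - x) g → Avoids g →
               IsShadowOf s (g ∨ x)
    shadow-∨ {s} {g} s-vertices x∈s g-shadow g-avoids v = mk⇔ to from
      where
      to : v ∈ s → IsVertex v × v ≤ (g ∨ x)
      to v∈s with v ≟ x
      ... | yes refl = s-vertices v v∈s , y≤x∨y g x
      ... | no  v≢x  = s-vertices v v∈s ,
                       ≤-trans (proj₂ (Equivalence.to (g-shadow v) (x∈p∧x≢y⇒x∈p-y v∈s v≢x))) (x≤x∨y g x)
      from : IsVertex v × v ≤ (g ∨ x) → v ∈ s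
      from (v-vertex , v≤h) with v ≟ x
      ... | yes refl = x∈s
      ... | no  v≢x  = p─q⊆p s _ (Equivalence.from (g-shadow v)
                         (v-vertex , ≤-join-vertex g-avoids (join-⋖ g-avoids) v-vertex v≢x v≤h))

  TranspositionPartnersOutside : Subset size → Set
  TranspositionPartnersOutside s = ∀ x → x ∈ s → IsVertex x × ∃[ w ] (w ∉ s × Transposition x w)

  shadow-of-transposable : (s : Subset size) → TranspositionPartnersOutside s →
                           Σ Elt λ g → IsShadowOf s g × (ρ g ≡ ∣ s ∣)
  shadow-of-transposable s = go (ℕ.<-wellFounded ∣ s ∣)
    where
    go : ∀ {s} → Acc ℕ._<_ ∣ s ∣ → TranspositionPartnersOutside s →
         Σ Elt λ g → IsShadowOf s g × (ρ g ≡ ∣ s ∣)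
    go {s} (acc smaller) partners with nonempty? s
    ... | no  s-empty =
      𝟎 , (λ v → mk⇔ (λ v∈s → ⊥-elim (s-empty (v , v∈s)))
                     (λ (v-vertex , v≤𝟎) →
                        ⊥-elim (proj₂ (𝟎<vertex v-vertex) (antisym (𝟎-minimum v) v≤𝟎)))) ,
      trans ρ-𝟎 (sym (trans (cong ∣_∣ (Empty-unique s-empty)) (∣⊥∣≡0 size)))
    ... | yes (x , x∈s) with partners x x∈s
    ...   | x-vertex , w , w∉s , t with go (smaller (x∈p⇒∣p-x∣<∣p∣ x∈s)) partners-s-x
      where
      partners-s-x : TranspositionPartnersOutside (s - x)
      partners-s-x u u∈s-x with partners u (p─q⊆p s _ u∈s-x)
      ... | u-vertex , w , w∉s , t = u-vertex , w , w∉s ∘ p─q⊆p s _ , t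
    ...     | g , g-shadow , ρg≡∣s-x∣ =
      g ∨ x , shadow-∨ (λ v → proj₁ ∘ partners v) x∈s g-shadow g-avoids ,
      trans (ρ-⋖ (join-⋖ g-avoids)) (trans (cong suc ρg≡∣s-x∣) (sym (∣p∣≡suc∣p-x∣ x∈s)))
      where
      open TranspositionProperties x-vertex (∈∧∉⇒≢ x∈s w∉s) t
      g-avoids : Avoids g
      g-avoids = (λ x≤g → x∈p─q⇒x∉q (Equivalence.from (g-shadow x) (x-vertex , x≤g)) (x∈⁅x⁆ x)) ,
                 (λ w≤g → w∉s (p─q⊆p s _ (Equivalence.from (g-shadow w) (y-vertex , w≤g))))

  ∼∧≢⇒transposition : ∀ {x w} → x ∼ w → x ≢ w → Transposition x w
  ∼∧≢⇒transposition (inj₁ x≡w) x≢w = ⊥-elim (x≢w x≡w)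
  ∼∧≢⇒transposition (inj₂ t)   _   = t

  missesOnePerClass⇒partnersOutside : ∀ {f} → MissesOnePerClass f → TranspositionPartnersOutside f
  missesOnePerClass⇒partnersOutside (f-vertices , f-misses) x x∈f with f-misses x (f-vertices x x∈f)
  ... | w , _ , x∼w , w∉f , _ = f-vertices x x∈f , w , w∉f , ∼∧≢⇒transposition x∼w (∈∧∉⇒≢ x∈f w∉f)

  missed-unique : ∀ {f v w} → MissesOnePerClass f →
                  IsVertex v → v ∉ f → IsVertex w → w ∉ f → v ∼ w → v ≡ w
  missed-unique (_ , f-misses) v-vertex v∉f w-vertex w∉f v∼w with f-misses _ v-vertex
  ... | _ , _ , _ , _ , unique =
    trans (unique _ v-vertex (inj₁ refl) v∉f) (sym (unique _ w-vertex v∼w w∉f))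

  transposition-conj : ∀ α {u w} → Transposition u w →
                       Transposition (Automorphism.φ α u) (Automorphism.φ α w)
  transposition-conj α {u} {w} (τ , τu≡w , τw≡u , τ-fixes) =
    (α ∘ᴬ τ) ∘ᴬ (α ⁻¹ᴬ) ,
    cong A.φ (trans (cong T.φ (A.φ⁻¹-φ u)) τu≡w) ,
    cong A.φ (trans (cong T.φ (A.φ⁻¹-φ w)) τw≡u) ,
    λ v v-vertex v≢αu v≢αw →
      trans (cong A.φ (τ-fixes (A.φ⁻¹ v) (trans (ρ-φ (α ⁻¹ᴬ) v) v-vertex) (≢-φ⁻¹ v≢αu) (≢-φ⁻¹ v≢αw)))
            (A.φ-φ⁻¹ v)
    where
    module A = AutomorphismProperties α
    module T = AutomorphismProperties τ
    ≢-φ⁻¹ : ∀ {v z} → v ≢ A.φ z → A.φ⁻¹ v ≢ z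
    ≢-φ⁻¹ {v} v≢αz α⁻¹v≡z = v≢αz (trans (sym (A.φ-φ⁻¹ v)) (cong A.φ α⁻¹v≡z))

  ∼-φ : ∀ α {u w} → u ∼ w → Automorphism.φ α u ∼ Automorphism.φ α w
  ∼-φ α (inj₁ u≡w) = inj₁ (cong (Automorphism.φ α) u≡w)
  ∼-φ α (inj₂ t)   = inj₂ (transposition-conj α t)

  image : Automorphism → Subset size → Subset size
  image α f = tabulate (lookup f ∘ AutomorphismProperties.φ⁻¹ α)

  module _ (α : Automorphism) {f : Subset size} where
    open AutomorphismProperties α

    ∈-image⁻ : ∀ {v} → v ∈ image α f → φ⁻¹ v ∈ f
    ∈-image⁻ {v} v∈ = lookup⇒[]= (φ⁻¹ v) f (trans (sym (lookup∘tabulate _ v)) ([]=⇒lookup v∈))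

    ∈-image⁺ : ∀ {u} → u ∈ f → φ u ∈ image α f
    ∈-image⁺ {u} u∈f = lookup⇒[]= (φ u) _ (trans (lookup∘tabulate _ (φ u))
      (subst (λ u' → lookup f u' ≡ inside) (sym (φ⁻¹-φ u)) ([]=⇒lookup u∈f)))

    mapsOnto-image : MapsOnto α f (image α f)
    mapsOnto-image v = mk⇔ (λ v∈ → φ⁻¹ v , ∈-image⁻ v∈ , φ-φ⁻¹ v) λ { (u , u∈f , refl) → ∈-image⁺ u∈f }

    image-missesOnePerClass : MissesOnePerClass f → MissesOnePerClass (image α f)
    image-missesOnePerClass (f-vertices , f-misses) = image-vertices , image-misses
      where
      φ⁻¹-vertex : ∀ {v} → IsVertex v → IsVertex (φ⁻¹ v)
      φ⁻¹-vertex v-vertex = trans (ρ-φ (α ⁻¹ᴬ) _) v-vertex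
      image-vertices : ∀ v → v ∈ image α f → IsVertex v
      image-vertices v v∈ =
        trans (cong ρ (sym (φ-φ⁻¹ v))) (trans (ρ-φ α (φ⁻¹ v)) (f-vertices _ (∈-image⁻ v∈)))
      image-misses : ∀ v → IsVertex v → Σ Elt λ w → IsVertex w × (v ∼ w) × (w ∉ image α f) ×
                       (∀ w' → IsVertex w' → v ∼ w' → w' ∉ image α f → w' ≡ w)
      image-misses v v-vertex with f-misses (φ⁻¹ v) (φ⁻¹-vertex v-vertex)
      ... | w , w-vertex , α⁻¹v∼w , w∉f , w-unique =
        φ w , trans (ρ-φ α w) w-vertex , subst (_∼ φ w) (φ-φ⁻¹ v) (∼-φ α α⁻¹v∼w) ,
        (λ φw∈ → w∉f (subst (_∈ f) (φ⁻¹-φ w) (∈-image⁻ φw∈))) ,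
        λ w' w'-vertex v∼w' w'∉ → trans (sym (φ-φ⁻¹ w')) (cong φ
          (w-unique (φ⁻¹ w') (φ⁻¹-vertex w'-vertex) (∼-φ (α ⁻¹ᴬ) v∼w')
                    (λ α⁻¹w'∈f → w'∉ (subst (_∈ image α f) (φ-φ⁻¹ w') (∈-image⁺ α⁻¹w'∈f)))))

  mapsOnto-∘ : ∀ {α β f g h} → MapsOnto α f g → MapsOnto β g h → MapsOnto (β ∘ᴬ α) f h
  mapsOnto-∘ {α} {β} {f} α-maps β-maps v = mk⇔ to from
    where
    to : v ∈ _ → Σ Elt λ u → u ∈ f × Automorphism.φ β (Automorphism.φ α u) ≡ v
    to v∈h with Equivalence.to (β-maps v) v∈h
    ... | u' , u'∈g , βu'≡v with Equivalence.to (α-maps u') u'∈g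
    ...   | u , u∈f , αu≡u' = u , u∈f , trans (cong (Automorphism.φ β) αu≡u') βu'≡v
    from : (Σ Elt λ u → u ∈ f × Automorphism.φ β (Automorphism.φ α u) ≡ v) → v ∈ _
    from (u , u∈f , βαu≡v) =
      Equivalence.from (β-maps v) (_ , Equivalence.from (α-maps _) (u , u∈f , refl) , βαu≡v)

  mapsOnto-id : ∀ {f f'} → f ⊆ f' → f' ⊆ f → MapsOnto idᴬ f f'
  mapsOnto-id f⊆f' f'⊆f v = mk⇔ (λ v∈f' → v , f'⊆f v∈f' , refl) λ { (_ , u∈f , refl) → f⊆f' u∈f }

  missesOnePerClass-⊆ : ∀ {f f'} → MissesOnePerClass f → MissesOnePerClass f' → f' ⊆ f → f ⊆ f'
  missesOnePerClass-⊆ {f} {f'} (f-vertices , f-misses) f'-misses f'⊆f {v} v∈f with v ∈? f'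
  ... | yes v∈f' = v∈f'
  ... | no  v∉f' with f-misses v (f-vertices v v∈f)
  ...   | w , w-vertex , v∼w , w∉f , _ =
    ⊥-elim (∈∧∉⇒≢ v∈f w∉f (missed-unique f'-misses (f-vertices v v∈f) v∉f' w-vertex (w∉f ∘ f'⊆f) v∼w))

  ∃-transposition-closer : ∀ {f f' v} → MissesOnePerClass f → MissesOnePerClass f' → v ∈ f' → v ∉ f →
                           ∃[ τ ] (∣ f' ─ image τ f ∣ ℕ.< ∣ f' ─ f ∣)
  ∃-transposition-closer {f} {f'} {v} f-misses (f'-vertices , f'-misses) v∈f' v∉f
    with f'-misses v (f'-vertices v v∈f')
  ... | w , w-vertex , v∼w , w∉f' , _ =
    τ , p⊂q⇒∣p∣<∣q∣ (f'─τf⊆f'─f , v , x∈p∧x∉q⇒x∈p─q v∈f' v∉f , λ v∈ → x∈p─q⇒x∉q v∈ v∈τf)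
    where
    t : Transposition v w
    t = ∼∧≢⇒transposition v∼w (∈∧∉⇒≢ v∈f' w∉f')
    τ : Automorphism
    τ = proj₁ t
    open TranspositionProperties (f'-vertices v v∈f') (∈∧∉⇒≢ v∈f' w∉f') t
    w∈f : w ∈ f
    w∈f with w ∈? f
    ... | yes w∈f = w∈f
    ... | no  w∉f =
      ⊥-elim (∈∧∉⇒≢ v∈f' w∉f' (missed-unique f-misses (f'-vertices v v∈f') v∉f w-vertex w∉f v∼w))
    v∈τf : v ∈ image τ f
    v∈τf = subst (_∈ image τ f) φy≡x (∈-image⁺ τ w∈f)
    f'─τf⊆f'─f : f' ─ image τ f ⊆ f' ─ f
    f'─τf⊆f'─f {u} u∈ = x∈p∧x∉q⇒x∈p─q u∈f' u∉f
      where
      u∈f' : u ∈ f'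
      u∈f' = p─q⊆p f' _ u∈
      u∉f : u ∉ f
      u∉f u∈f with u ≟ v | u ≟ w
      ... | yes refl | _        = v∉f u∈f
      ... | no  _    | yes refl = w∉f' u∈f'
      ... | no  u≢v  | no  u≢w  =
        x∈p─q⇒x∉q u∈ (subst (_∈ image τ f) (φ-fixes u (f'-vertices u u∈f') u≢v u≢w) (∈-image⁺ τ u∈f))

  automorphism-between : ∀ {f f'} → MissesOnePerClass f → MissesOnePerClass f' →
                         Σ Automorphism λ α → MapsOnto α f f'
  automorphism-between {f} {f'} f-misses f'-misses = go (ℕ.<-wellFounded ∣ f' ─ f ∣) f-misses
    where
    go : ∀ {f} → Acc ℕ._<_ ∣ f' ─ f ∣ → MissesOnePerClass f → Σ Automorphism λ α → MapsOnto α f f'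
    go {f} (acc smaller) f-misses with nonempty? (f' ─ f)
    ... | no  f'─f-empty = idᴬ , mapsOnto-id (missesOnePerClass-⊆ f-misses f'-misses f'⊆f) f'⊆f
      where
      f'⊆f : f' ⊆ f
      f'⊆f {v} v∈f' with v ∈? f
      ... | yes v∈f = v∈f
      ... | no  v∉f = ⊥-elim (f'─f-empty (v , x∈p∧x∉q⇒x∈p─q v∈f' v∉f))
    ... | yes (v , v∈f'─f)
      with ∃-transposition-closer f-misses f'-misses (p─q⊆p f' f v∈f'─f) (x∈p─q⇒x∉q v∈f'─f)
    ...   | τ , closer with go (smaller closer) (image-missesOnePerClass τ f-misses)
    ...     | β , β-maps = β ∘ᴬ τ , mapsOnto-∘ {τ} {β} (mapsOnto-image τ) β-maps

lemma4p3 : (M : CellularPseudomanifold) → let open CellularPseudomanifold M in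
    ((f : Subset size) → MissesOnePerClass f →
       Σ Elt λ g → IsShadowOf f g × (ρ g ≡ ∣ f ∣))
    × ((f f' : Subset size) → MissesOnePerClass f → MissesOnePerClass f' →
       Σ Automorphism λ α → MapsOnto α f f')
lemma4p3 M = (λ f f-misses → shadow-of-transposable f (missesOnePerClass⇒partnersOutside f-misses)) ,
             (λ f f' → automorphism-between)
  where open CellularPseudomanifoldProperties M
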